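{- Let $t$ be a positive integer and $r$ any integer. Identify a $4$-subset $\{(x_0,0),(x_1,1),(x_2,2),(x_3,3)\}$ of $\mathbb{Z}_t\times\mathbb{Z}_4$ with $(x_0,x_1,x_2,x_3)\in\mathbb{Z}_t^4$, with addition of quadruples coordinatewise modulo $t$ and sums of sets defined elementwise. Let $\mathcal{A}=\{(i,i,i,i):i\in\mathbb{Z}_t\}$, $\mathcal{B}=\{(i,0,i,0):i\in\mathbb{Z}_t\}$, $\mathcal{C}=\{(i,i,0,0):i\in\mathbb{Z}_t\}$, and $\mathcal{S}=\{(r,0,0,0)\}+\mathcal{A}+\mathcal{B}+\mathcal{C}$. Then $\mathcal{S}$ contains $t^3$ quadruples, and every triple $\{(x_1,i),(x_2,j),(x_3,k)\}$ with $x_1,x_2,x_3\in\mathbb{Z}_t$ and $|\{i,j,k\}|=3$ is contained in exactly one quadruple of $\mathcal{S}$. -}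

module Defs where

open import Data.Nat as ℕ using (ℕ; NonZero)
open import Data.Nat.DivMod using (_mod_)
open import Data.Integer as ℤ using (ℤ; _%ℕ_)
open import Data.Fin using (Fin; toℕ; zero; suc)
open import Data.Fin.Properties using () renaming (_≟_ to _≟F_)
open import Data.Vec using (Vec; []; _∷_; zipWith; lookup)
open import Data.Vec.Properties using (≡-dec)
open import Data.List using (List; []; _∷_; map; concatMap; allFin)
open import Data.List.Membership.Propositional using (_∈_)
open import Data.Product using (Σ; _×_)
open import Relation.Binary.PropositionalEquality using (_≡_)
open import Relation.Binary.Definitions using (DecidableEquality)

_+ₜ_ : ∀ {t} .{{_ : NonZero t}} → Fin t → Fin t → Fin t
_+ₜ_ {t} x y = (toℕ x ℕ.+ toℕ y) mod t

[_]ₜ : ∀ {t} .{{_ : NonZero t}} → ℤ → Fin t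
[_]ₜ {t} r = (r %ℕ t) mod t

-- a 4-subset {(x0,0),(x1,1),(x2,2),(x3,3)} of ℤ_t × ℤ_4, as (x0,x1,x2,x3)
Quad : ℕ → Set
Quad t = Vec (Fin t) 4

quad : ∀ {t} → Fin t → Fin t → Fin t → Fin t → Quad t
quad a b c d = a ∷ b ∷ c ∷ d ∷ []

_≟Q_ : ∀ {t} → DecidableEquality (Quad t)
_≟Q_ = ≡-dec _≟F_

_+Q_ : ∀ {t} .{{_ : NonZero t}} → Quad t → Quad t → Quad t
_+Q_ = zipWith _+ₜ_

_⊕_ : ∀ {t} .{{_ : NonZero t}} → List (Quad t) → List (Quad t) → List (Quad t)
xs ⊕ ys = concatMap (λ x → map (x +Q_) ys) xs

infixl 6 _⊕_

𝒜 : ∀ t → List (Quad t)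
𝒜 t = map (λ i → quad i i i i) (allFin t)

ℬ : ∀ t .{{_ : NonZero t}} → List (Quad t)
ℬ t@(ℕ.suc _) = map (λ i → quad i zero i zero) (allFin t)

𝒞 : ∀ t .{{_ : NonZero t}} → List (Quad t)
𝒞 t@(ℕ.suc _) = map (λ i → quad i i zero zero) (allFin t)

𝒮 : ∀ t .{{_ : NonZero t}} → ℤ → List (Quad t)
𝒮 t@(ℕ.suc _) r = (quad [ r ]ₜ zero zero zero ∷ []) ⊕ 𝒜 t ⊕ ℬ t ⊕ 𝒞 t

_∋ₚ_,_ : ∀ {t} → Quad t → Fin t → Fin 4 → Set
q ∋ₚ x , i = lookup q i ≡ x

module Submission where

-- Writing a quadruple as (x₀, x₁, x₂, x₃), the elements of 𝒮 are (r + a + b + c, a + c, a + b, a)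
-- for a, b, c ∈ ℤ_t, and these are exactly the solutions of x₀ + x₃ = r + x₁ + x₂. The three
-- summands are read off from the last coordinates, so the t³ sums are pairwise distinct. Every
-- coordinate occurs in the equation with a unit coefficient, so any three coordinates of a
-- solution determine the fourth, and every choice of three coordinates extends to a solution.

open import Defs
open import Algebra.Bundles using (AbelianGroup)
open import Level using (0ℓ)
open import Data.Nat using (ℕ; suc; NonZero; _+_; _*_; _∸_; _^_)
open import Data.Nat.Properties using (+-comm; +-assoc; m+[n∸m]≡n; <⇒≤)
open import Data.Nat.DivMod using (_%_; _mod_; m%n<n; %-distribˡ-+; m%n%n≡m%n; m<n⇒m%n≡m; n%n≡0)
open import Data.Nat.Solver using (module +-*-Solver)
open import Data.Integer using (ℤ)
open import Data.Fin using (Fin; toℕ; zero; _≟_)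
open import Data.Fin.Patterns using (0F; 1F; 2F; 3F)
open import Data.Fin.Properties using (toℕ-fromℕ<; toℕ-injective; toℕ<n; all?; any?)
open import Data.Vec using (Vec; []; _∷_; lookup; replicate; _[_]≔_)
open import Data.Vec.Properties
  using (lookup∘update; lookup∘update′; lookup-replicate; lookup-zipWith; tabulate∘lookup; tabulate-cong)
open import Data.List
  using (List; []; _∷_; map; _++_; length; allFin; filter; deduplicate; cartesianProductWith)
open import Data.List.Properties using (length-++; length-map; length-tabulate; filter-all)
open import Data.List.Membership.Propositional using (_∈_)
open import Data.List.Membership.Propositional.Properties
  using (∈-map⁺; ∈-map⁻; ∈-allFin; ∈-cartesianProductWith⁺; ∈-cartesianProductWith⁻)
import Data.List.Relation.Unary.All as All
open import Data.List.Relation.Unary.Any using (here; there)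
open import Data.List.Relation.Unary.AllPairs using ([]; _∷_)
open import Data.List.Relation.Unary.Unique.Propositional using (Unique)
import Data.List.Relation.Unary.Unique.Propositional.Properties as Unique
open import Data.Product using (Σ; Σ-syntax; ∃-syntax; _×_; _,_)
open import Data.Sum using (_⊎_; inj₁; inj₂)
open import Function using (_∘_)
open import Relation.Nullary using (¬_; ¬?; yes; no)
open import Relation.Nullary.Decidable using (_×-dec_; _⊎-dec_; _→-dec_; toWitness)
open import Relation.Binary.Definitions using (DecidableEquality)
open import Relation.Binary.PropositionalEquality
  using (_≡_; _≢_; _≗_; refl; cong; cong₂; subst; isEquivalence; module ≡-Reasoning)
import Relation.Binary.PropositionalEquality as ≡

module _ {n : ℕ} where

  private
    N : ℕ
    N = suc n

  toℕ-+ₜ : (x y : Fin N) → toℕ (x +ₜ y) ≡ (toℕ x + toℕ y) % N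
  toℕ-+ₜ x y = toℕ-fromℕ< (m%n<n (toℕ x + toℕ y) N)

  %-absorbˡ-+ : ∀ m k → (m % N + k) % N ≡ (m + k) % N
  %-absorbˡ-+ m k = begin
    (m % N + k) % N          ≡⟨ %-distribˡ-+ (m % N) k N ⟩
    (m % N % N + k % N) % N  ≡⟨ cong (λ z → (z + k % N) % N) (m%n%n≡m%n m N) ⟩
    (m % N + k % N) % N      ≡⟨ %-distribˡ-+ m k N ⟨
    (m + k) % N              ∎
    where open ≡-Reasoning

  %-absorbʳ-+ : ∀ m k → (m + k % N) % N ≡ (m + k) % N
  %-absorbʳ-+ m k = begin
    (m + k % N) % N          ≡⟨ %-distribˡ-+ m (k % N) N ⟩
    (m % N + k % N % N) % N  ≡⟨ cong (λ z → (m % N + z) % N) (m%n%n≡m%n k N) ⟩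
    (m % N + k % N) % N      ≡⟨ %-distribˡ-+ m k N ⟨
    (m + k) % N              ∎
    where open ≡-Reasoning

  +ₜ-comm : (x y : Fin N) → x +ₜ y ≡ y +ₜ x
  +ₜ-comm x y = toℕ-injective (begin
    toℕ (x +ₜ y)         ≡⟨ toℕ-+ₜ x y ⟩
    (toℕ x + toℕ y) % N  ≡⟨ cong (_% N) (+-comm (toℕ x) (toℕ y)) ⟩
    (toℕ y + toℕ x) % N  ≡⟨ toℕ-+ₜ y x ⟨
    toℕ (y +ₜ x)         ∎)
    where open ≡-Reasoning

  +ₜ-assoc : (x y z : Fin N) → (x +ₜ y) +ₜ z ≡ x +ₜ (y +ₜ z)
  +ₜ-assoc x y z = toℕ-injective (begin
    toℕ ((x +ₜ y) +ₜ z)                ≡⟨ toℕ-+ₜ (x +ₜ y) z ⟩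
    (toℕ (x +ₜ y) + toℕ z) % N         ≡⟨ cong (λ w → (w + toℕ z) % N) (toℕ-+ₜ x y) ⟩
    ((toℕ x + toℕ y) % N + toℕ z) % N  ≡⟨ %-absorbˡ-+ (toℕ x + toℕ y) (toℕ z) ⟩
    (toℕ x + toℕ y + toℕ z) % N        ≡⟨ cong (_% N) (+-assoc (toℕ x) (toℕ y) (toℕ z)) ⟩
    (toℕ x + (toℕ y + toℕ z)) % N      ≡⟨ %-absorbʳ-+ (toℕ x) (toℕ y + toℕ z) ⟨
    (toℕ x + (toℕ y + toℕ z) % N) % N  ≡⟨ cong (λ w → (toℕ x + w) % N) (toℕ-+ₜ y z) ⟨
    (toℕ x + toℕ (y +ₜ z)) % N         ≡⟨ toℕ-+ₜ x (y +ₜ z) ⟨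
    toℕ (x +ₜ (y +ₜ z))                ∎)
    where open ≡-Reasoning

  +ₜ-identityˡ : (x : Fin N) → zero +ₜ x ≡ x
  +ₜ-identityˡ x = toℕ-injective (≡.trans (toℕ-+ₜ zero x) (m<n⇒m%n≡m (toℕ<n x)))

  -ₜ_ : Fin N → Fin N
  -ₜ x = (N ∸ toℕ x) mod N

  +ₜ-inverseʳ : (x : Fin N) → x +ₜ (-ₜ x) ≡ zero
  +ₜ-inverseʳ x = toℕ-injective (begin
    toℕ (x +ₜ (-ₜ x))              ≡⟨ toℕ-+ₜ x (-ₜ x) ⟩
    (toℕ x + toℕ (-ₜ x)) % N       ≡⟨ cong (λ w → (toℕ x + w) % N) (toℕ-fromℕ< (m%n<n (N ∸ toℕ x) N)) ⟩
    (toℕ x + (N ∸ toℕ x) % N) % N  ≡⟨ %-absorbʳ-+ (toℕ x) (N ∸ toℕ x) ⟩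
    (toℕ x + (N ∸ toℕ x)) % N      ≡⟨ cong (_% N) (m+[n∸m]≡n (<⇒≤ (toℕ<n x))) ⟩
    N % N                          ≡⟨ n%n≡0 N ⟩
    0                              ∎)
    where open ≡-Reasoning

ℤₜ-abelianGroup : ℕ → AbelianGroup 0ℓ 0ℓ
ℤₜ-abelianGroup n = record
  { Carrier        = Fin (suc n)
  ; _≈_            = _≡_
  ; _∙_            = _+ₜ_
  ; ε              = zero
  ; _⁻¹            = -ₜ_
  ; isAbelianGroup = record
    { isGroup = record
      { isMonoid = record
        { isSemigroup = record
          { isMagma = record { isEquivalence = isEquivalence ; ∙-cong = cong₂ _+ₜ_ }
          ; assoc   = +ₜ-assoc
          }
        ; identity = +ₜ-identityˡ , λ x → ≡.trans (+ₜ-comm x zero) (+ₜ-identityˡ x)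
        }
      ; inverse = (λ x → ≡.trans (+ₜ-comm (-ₜ x) x) (+ₜ-inverseʳ x)) , +ₜ-inverseʳ
      ; ⁻¹-cong = cong -ₜ_
      }
    ; comm = +ₜ-comm
    }
  }

-- An exhaustive check over Fin 4, kept opaque so that the decision procedure is not unfolded
-- wherever the lemma is used.
opaque
  complement : ∀ {i j k : Fin 4} → i ≢ j → i ≢ k → j ≢ k →
    ∃[ l ] l ≢ i × l ≢ j × l ≢ k × (∀ m → m ≢ l → m ≡ i ⊎ m ≡ j ⊎ m ≡ k)
  complement {i} {j} {k} = toWitness {a? = all? λ i → all? λ j → all? λ k →
    ¬? (i ≟ j) →-dec ¬? (i ≟ k) →-dec ¬? (j ≟ k) →-dec
    any? λ l → ¬? (l ≟ i) ×-dec ¬? (l ≟ j) ×-dec ¬? (l ≟ k) ×-dec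
      all? λ m → ¬? (m ≟ l) →-dec (m ≟ i ⊎-dec m ≟ j ⊎-dec m ≟ k)} _ i j k

module Plane {c ℓ} (G : AbelianGroup c ℓ) (r : AbelianGroup.Carrier G) where

  open AbelianGroup G hiding (refl)
  open import Algebra.Properties.AbelianGroup G using (x≈z//y; //-rightDividesˡ; //-cong₂)
  open import Algebra.Properties.CommutativeSemigroup commutativeSemigroup using (xy∙z≈y∙xz)
  open import Relation.Binary.Reasoning.Setoid setoid

  OnPlane : Vec Carrier 4 → Set ℓ
  OnPlane (v₀ ∷ v₁ ∷ v₂ ∷ v₃ ∷ []) = v₀ ∙ v₃ ≈ r ∙ v₁ ∙ v₂

  solveFor : Fin 4 → Vec Carrier 4 → Carrier
  solveFor 0F (_  ∷ v₁ ∷ v₂ ∷ v₃ ∷ []) = r ∙ v₁ ∙ v₂ - v₃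
  solveFor 1F (v₀ ∷ _  ∷ v₂ ∷ v₃ ∷ []) = v₀ ∙ v₃ - r ∙ v₂
  solveFor 2F (v₀ ∷ v₁ ∷ _  ∷ v₃ ∷ []) = v₀ ∙ v₃ - r ∙ v₁
  solveFor 3F (v₀ ∷ v₁ ∷ v₂ ∷ _  ∷ []) = r ∙ v₁ ∙ v₂ - v₀

  onPlane⇒≈solveFor : ∀ l v → OnPlane v → lookup v l ≈ solveFor l v
  onPlane⇒≈solveFor 0F (v₀ ∷ _  ∷ _  ∷ v₃ ∷ []) e = x≈z//y v₀ v₃ _ e
  onPlane⇒≈solveFor 1F (_  ∷ v₁ ∷ v₂ ∷ _  ∷ []) e =
    x≈z//y v₁ (r ∙ v₂) _ (sym (trans e (xy∙z≈y∙xz r v₁ v₂)))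
  onPlane⇒≈solveFor 2F (_  ∷ v₁ ∷ v₂ ∷ _  ∷ []) e =
    x≈z//y v₂ (r ∙ v₁) _ (sym (trans e (comm (r ∙ v₁) v₂)))
  onPlane⇒≈solveFor 3F (v₀ ∷ _  ∷ _  ∷ v₃ ∷ []) e = x≈z//y v₃ v₀ _ (trans (comm v₃ v₀) e)

  solveFor-cong : ∀ l {v w} → (∀ m → m ≢ l → lookup v m ≈ lookup w m) → solveFor l v ≈ solveFor l w
  solveFor-cong 0F {_ ∷ _ ∷ _ ∷ _ ∷ []} {_ ∷ _ ∷ _ ∷ _ ∷ []} e =
    //-cong₂ (∙-cong (∙-congˡ (e 1F λ ())) (e 2F λ ())) (e 3F λ ())
  solveFor-cong 1F {_ ∷ _ ∷ _ ∷ _ ∷ []} {_ ∷ _ ∷ _ ∷ _ ∷ []} e =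
    //-cong₂ (∙-cong (e 0F λ ()) (e 3F λ ())) (∙-congˡ (e 2F λ ()))
  solveFor-cong 2F {_ ∷ _ ∷ _ ∷ _ ∷ []} {_ ∷ _ ∷ _ ∷ _ ∷ []} e =
    //-cong₂ (∙-cong (e 0F λ ()) (e 3F λ ())) (∙-congˡ (e 1F λ ()))
  solveFor-cong 3F {_ ∷ _ ∷ _ ∷ _ ∷ []} {_ ∷ _ ∷ _ ∷ _ ∷ []} e =
    //-cong₂ (∙-cong (∙-congˡ (e 1F λ ())) (e 2F λ ())) (e 0F λ ())

  onPlane-update : ∀ l v → OnPlane (v [ l ]≔ solveFor l v)
  onPlane-update 0F (_  ∷ _  ∷ _  ∷ v₃ ∷ []) = //-rightDividesˡ v₃ _
  onPlane-update 1F (_  ∷ _  ∷ v₂ ∷ _  ∷ []) =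
    sym (trans (xy∙z≈y∙xz r _ v₂) (//-rightDividesˡ (r ∙ v₂) _))
  onPlane-update 2F (_  ∷ v₁ ∷ _  ∷ _  ∷ []) =
    sym (trans (comm (r ∙ v₁) _) (//-rightDividesˡ (r ∙ v₁) _))
  onPlane-update 3F (v₀ ∷ _  ∷ _  ∷ _  ∷ []) = trans (comm v₀ _) (//-rightDividesˡ v₀ _)

  onPlane-through : ∀ {i j k} → i ≢ j → i ≢ k → j ≢ k → ∀ x y z →
    Σ[ v ∈ Vec Carrier 4 ] OnPlane v × lookup v i ≡ x × lookup v j ≡ y × lookup v k ≡ z
  onPlane-through {i} {j} {k} i≢j i≢k j≢k x y z with complement i≢j i≢k j≢k
  ... | l , l≢i , l≢j , l≢k , _ = v , onPlane-update l u , vᵢ , vⱼ , vₖ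
    where
    u₀ u v : Vec Carrier 4
    u₀ = replicate 4 x [ j ]≔ y
    u  = u₀ [ k ]≔ z
    v  = u [ l ]≔ solveFor l u
    vᵢ : lookup v i ≡ x
    vᵢ = ≡.trans (lookup∘update′ (l≢i ∘ ≡.sym) u _) (≡.trans (lookup∘update′ i≢k u₀ z)
           (≡.trans (lookup∘update′ i≢j (replicate 4 x) y) (lookup-replicate i x)))
    vⱼ : lookup v j ≡ y
    vⱼ = ≡.trans (lookup∘update′ (l≢j ∘ ≡.sym) u _)
           (≡.trans (lookup∘update′ j≢k u₀ z) (lookup∘update j (replicate 4 x) y))
    vₖ : lookup v k ≡ z
    vₖ = ≡.trans (lookup∘update′ (l≢k ∘ ≡.sym) u _) (lookup∘update k u₀ z)

  onPlane-unique : ∀ {i j k} → i ≢ j → i ≢ k → j ≢ k → ∀ {v w} → OnPlane v → OnPlane w →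
    lookup v i ≈ lookup w i → lookup v j ≈ lookup w j → lookup v k ≈ lookup w k →
    ∀ m → lookup v m ≈ lookup w m
  onPlane-unique i≢j i≢k j≢k {v} {w} v-on w-on vᵢ vⱼ vₖ with complement i≢j i≢k j≢k
  ... | l , _ , _ , _ , cover = agree
    where
    agree-off-l : ∀ m → m ≢ l → lookup v m ≈ lookup w m
    agree-off-l m m≢l with cover m m≢l
    ... | inj₁ refl        = vᵢ
    ... | inj₂ (inj₁ refl) = vⱼ
    ... | inj₂ (inj₂ refl) = vₖ
    agree : ∀ m → lookup v m ≈ lookup w m
    agree m with m ≟ l
    ... | no m≢l   = agree-off-l m m≢l
    ... | yes refl = begin
      lookup v m    ≈⟨ onPlane⇒≈solveFor m v v-on ⟩
      solveFor m v  ≈⟨ solveFor-cong m agree-off-l ⟩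
      solveFor m w  ≈⟨ onPlane⇒≈solveFor m w w-on ⟨
      lookup w m    ∎

lookup-≗⇒≡ : ∀ {a} {A : Set a} {m} {v w : Vec A m} → lookup v ≗ lookup w → v ≡ w
lookup-≗⇒≡ {v = v} {w} e =
  ≡.trans (≡.sym (tabulate∘lookup v)) (≡.trans (tabulate-cong e) (tabulate∘lookup w))

deduplicate-unique : ∀ {a} {A : Set a} (_≟_ : DecidableEquality A) {xs : List A} →
  Unique xs → deduplicate _≟_ xs ≡ xs
deduplicate-unique _≟_ []                    = refl
deduplicate-unique _≟_ {x ∷ xs} (x∉xs ∷ xs!) = cong (x ∷_) (begin
  filter (¬? ∘ (x ≟_)) (deduplicate _≟_ xs)  ≡⟨ cong (filter (¬? ∘ (x ≟_))) (deduplicate-unique _≟_ xs!) ⟩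
  filter (¬? ∘ (x ≟_)) xs                    ≡⟨ filter-all (¬? ∘ (x ≟_)) x∉xs ⟩
  xs                                         ∎)
  where open ≡-Reasoning

module _ {n : ℕ} where

  open import Algebra.Properties.AbelianGroup (ℤₜ-abelianGroup n) using (∙-cancelˡ)

  private
    N : ℕ
    N = suc n

  ⊕-cartesianProductWith : (xs ys : List (Quad N)) → xs ⊕ ys ≡ cartesianProductWith _+Q_ xs ys
  ⊕-cartesianProductWith []       ys = refl
  ⊕-cartesianProductWith (x ∷ xs) ys = cong (map (x +Q_) ys ++_) (⊕-cartesianProductWith xs ys)

  ∈-⊕⁺ : ∀ {xs ys : List (Quad N)} {x y} → x ∈ xs → y ∈ ys → x +Q y ∈ xs ⊕ ys
  ∈-⊕⁺ {xs} {ys} x∈ y∈ =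
    subst (_ ∈_) (≡.sym (⊕-cartesianProductWith xs ys)) (∈-cartesianProductWith⁺ _+Q_ x∈ y∈)

  ∈-⊕⁻ : ∀ (xs ys : List (Quad N)) {v} → v ∈ xs ⊕ ys → ∃[ x ] ∃[ y ] x ∈ xs × y ∈ ys × v ≡ x +Q y
  ∈-⊕⁻ xs ys v∈ = ∈-cartesianProductWith⁻ _+Q_ xs ys (subst (_ ∈_) (⊕-cartesianProductWith xs ys) v∈)

  length-⊕ : (xs ys : List (Quad N)) → length (xs ⊕ ys) ≡ length xs * length ys
  length-⊕ []       ys = refl
  length-⊕ (x ∷ xs) ys = begin
    length (map (x +Q_) ys ++ xs ⊕ ys)          ≡⟨ length-++ (map (x +Q_) ys) ⟩
    length (map (x +Q_) ys) + length (xs ⊕ ys)  ≡⟨ cong₂ _+_ (length-map (x +Q_) ys) (length-⊕ xs ys) ⟩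
    length ys + length xs * length ys           ∎
    where open ≡-Reasoning

  +Q-cancelˡ : ∀ (x : Quad N) {y y′} → x +Q y ≡ x +Q y′ → y ≡ y′
  +Q-cancelˡ x {y} {y′} e = lookup-≗⇒≡ λ m → ∙-cancelˡ (lookup x m) _ _ (begin
    lookup x m +ₜ lookup y m   ≡⟨ lookup-zipWith _+ₜ_ m x y ⟨
    lookup (x +Q y) m          ≡⟨ cong (λ v → lookup v m) e ⟩
    lookup (x +Q y′) m         ≡⟨ lookup-zipWith _+ₜ_ m x y′ ⟩
    lookup x m +ₜ lookup y′ m  ∎)
    where open ≡-Reasoning

  Unique-⊕ : ∀ {xs ys : List (Quad N)} → Unique xs → Unique ys →
    (∀ {x x′ y y′} → x ∈ xs → x′ ∈ xs → y ∈ ys → y′ ∈ ys → x +Q y ≡ x′ +Q y′ → x ≡ x′) →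
    Unique (xs ⊕ ys)
  Unique-⊕ {[]}          _            _   _          = []
  Unique-⊕ {x ∷ xs} {ys} (x∉xs ∷ xs!) ys! determined =
    Unique.++⁺ (Unique.map⁺ (+Q-cancelˡ x) ys!)
               (Unique-⊕ xs! ys! λ x∈ x′∈ → determined (there x∈) (there x′∈))
               disjoint
    where
    disjoint : ∀ {v} → ¬ (v ∈ map (x +Q_) ys × v ∈ xs ⊕ ys)
    disjoint (v∈ , v∈′) with ∈-map⁻ (x +Q_) v∈ | ∈-⊕⁻ xs ys v∈′
    ... | y , y∈ , refl | x′ , y′ , x′∈ , y′∈ , e =
      All.lookup x∉xs x′∈ (determined (here refl) (there x′∈) y∈ y′∈ e)

module Design (n : ℕ) (r : ℤ) where

  private
    N : ℕ
    N = suc n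
    ℤₜ = ℤₜ-abelianGroup n

  open AbelianGroup ℤₜ using (identityˡ; identityʳ; comm; commutativeMonoid; _-_)
  open import Algebra.Properties.AbelianGroup ℤₜ using (∙-cancelˡ; ∙-cancelʳ; //-rightDividesˡ)

  ρ : Fin N
  ρ = [ r ]ₜ

  open Plane ℤₜ ρ

  point : Fin N → Fin N → Fin N → Quad N
  point a b c = quad (((ρ +ₜ a) +ₜ b) +ₜ c) (a +ₜ c) (a +ₜ b) a

  s : Quad N
  s = quad ρ zero zero zero

  𝒮₁ 𝒮₂ : List (Quad N)
  𝒮₁ = (s ∷ []) ⊕ 𝒜 N
  𝒮₂ = 𝒮₁ ⊕ ℬ N

  ∈𝒮₁ : ∀ {x} → x ∈ 𝒮₁ → ∃[ a ] x ≡ s +Q quad a a a a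
  ∈𝒮₁ x∈ with ∈-⊕⁻ (s ∷ []) (𝒜 N) x∈
  ... | _ , _ , here refl , y∈ , refl with ∈-map⁻ _ y∈
  ...   | a , _ , refl = a , refl

  ∈𝒮₂ : ∀ {x} → x ∈ 𝒮₂ → ∃[ a ] ∃[ b ] x ≡ (s +Q quad a a a a) +Q quad b zero b zero
  ∈𝒮₂ x∈ with ∈-⊕⁻ 𝒮₁ (ℬ N) x∈
  ... | _ , _ , x∈′ , y∈ , refl with ∈𝒮₁ x∈′ | ∈-map⁻ _ y∈
  ...   | a , refl | b , _ , refl = a , b , refl

  sum≡point : ∀ a b c → ((s +Q quad a a a a) +Q quad b zero b zero) +Q quad c c zero zero ≡ point a b c
  sum≡point a b c rewrite identityˡ a | identityʳ a | identityʳ a | identityʳ (a +ₜ b) = refl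

  ∈𝒮⇒point : ∀ {q} → q ∈ 𝒮 N r → ∃[ a ] ∃[ b ] ∃[ c ] q ≡ point a b c
  ∈𝒮⇒point q∈ with ∈-⊕⁻ 𝒮₂ (𝒞 N) q∈
  ... | _ , _ , x∈ , y∈ , refl with ∈𝒮₂ x∈ | ∈-map⁻ _ y∈
  ...   | a , b , refl | c , _ , refl = a , b , c , sum≡point a b c

  point∈𝒮 : ∀ a b c → point a b c ∈ 𝒮 N r
  point∈𝒮 a b c = subst (_∈ 𝒮 N r) (sum≡point a b c)
    (∈-⊕⁺ {xs = 𝒮₂} (∈-⊕⁺ {xs = 𝒮₁} (∈-⊕⁺ {xs = s ∷ []} (here refl)
      (∈-map⁺ _ (∈-allFin a))) (∈-map⁺ _ (∈-allFin b))) (∈-map⁺ _ (∈-allFin c)))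

  -- The elements of ℬ vanish in coordinate 3 and those of 𝒞 in coordinates 2 and 3,
  -- where the partial sums carry a and a + b.
  𝒮₁-determined : ∀ {x x′ y y′} → x ∈ 𝒮₁ → x′ ∈ 𝒮₁ → y ∈ ℬ N → y′ ∈ ℬ N →
    x +Q y ≡ x′ +Q y′ → x ≡ x′
  𝒮₁-determined x∈ x′∈ y∈ y′∈ e with ∈𝒮₁ x∈ | ∈𝒮₁ x′∈ | ∈-map⁻ _ y∈ | ∈-map⁻ _ y′∈
  ... | a , refl | a′ , refl | _ , _ , refl | _ , _ , refl =
    cong (λ a → s +Q quad a a a a) (∙-cancelˡ zero a a′ (∙-cancelʳ zero _ _ (cong (λ v → lookup v 3F) e)))

  𝒮₂-determined : ∀ {x x′ y y′} → x ∈ 𝒮₂ → x′ ∈ 𝒮₂ → y ∈ 𝒞 N → y′ ∈ 𝒞 N →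
    x +Q y ≡ x′ +Q y′ → x ≡ x′
  𝒮₂-determined x∈ x′∈ y∈ y′∈ e with ∈𝒮₂ x∈ | ∈𝒮₂ x′∈ | ∈-map⁻ _ y∈ | ∈-map⁻ _ y′∈
  ... | a , b , refl | a′ , b′ , refl | _ , _ , refl | _ , _ , refl
    with ∙-cancelˡ zero a a′ (∙-cancelʳ zero _ _ (∙-cancelʳ zero _ _ (cong (λ v → lookup v 3F) e)))
  ... | refl = cong (λ b → (s +Q quad a a a a) +Q quad b zero b zero)
                    (∙-cancelˡ (zero +ₜ a) b b′ (∙-cancelʳ zero _ _ (cong (λ v → lookup v 2F) e)))

  𝒮-unique : Unique (𝒮 N r)
  𝒮-unique = Unique-⊕ (Unique-⊕ (Unique-⊕ (All.[] ∷ []) (image-unique λ { refl → refl })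
                                          λ { (here refl) (here refl) _ _ _ → refl })
                                (image-unique λ { refl → refl }) 𝒮₁-determined)
                      (image-unique λ { refl → refl }) 𝒮₂-determined
    where
    image-unique : ∀ {f : Fin N → Quad N} → (∀ {a b} → f a ≡ f b → a ≡ b) → Unique (map f (allFin N))
    image-unique f-injective = Unique.map⁺ f-injective (Unique.allFin⁺ N)

  length-𝒮 : length (𝒮 N r) ≡ N ^ 3
  length-𝒮 = begin
    length (𝒮₂ ⊕ 𝒞 N)  ≡⟨ length-⊕-allFin 𝒮₂ ⟩
    length 𝒮₂ * N      ≡⟨ cong (_* N) (length-⊕-allFin 𝒮₁) ⟩
    length 𝒮₁ * N * N  ≡⟨ cong (λ m → m * N * N) (length-⊕-allFin (s ∷ [])) ⟩
    1 * N * N * N      ≡⟨ solve 1 (λ N → con 1 :* N :* N :* N := N :^ 3) refl N ⟩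
    N ^ 3              ∎
    where
    open ≡-Reasoning
    open +-*-Solver
    length-⊕-allFin : ∀ xs {f : Fin N → Quad N} → length (xs ⊕ map f (allFin N)) ≡ length xs * N
    length-⊕-allFin xs {f} = ≡.trans (length-⊕ xs _)
      (cong (length xs *_) (≡.trans (length-map f (allFin N)) (length-tabulate (λ i → i))))

  point-onPlane : ∀ a b c → OnPlane (point a b c)
  point-onPlane a b c = prove 4
    ((((ρ′ ⊕′ a′) ⊕′ b′) ⊕′ c′) ⊕′ a′)
    ((ρ′ ⊕′ (a′ ⊕′ c′)) ⊕′ (a′ ⊕′ b′))
    (ρ ∷ a ∷ b ∷ c ∷ [])
    where
    open import Algebra.Solver.CommutativeMonoid commutativeMonoid renaming (_⊕_ to _⊕′_)
    ρ′ = var 0F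
    a′ = var 1F
    b′ = var 2F
    c′ = var 3F

  ∈𝒮⇒onPlane : ∀ {q} → q ∈ 𝒮 N r → OnPlane q
  ∈𝒮⇒onPlane q∈ with ∈𝒮⇒point q∈
  ... | a , b , c , refl = point-onPlane a b c

  onPlane⇒∈𝒮 : ∀ q → OnPlane q → q ∈ 𝒮 N r
  onPlane⇒∈𝒮 q@(_ ∷ q₁ ∷ q₂ ∷ q₃ ∷ []) q-on =
    subst (_∈ 𝒮 N r) point≡q (point∈𝒮 q₃ (q₂ - q₃) (q₁ - q₃))
    where
    x+[y-x]≡y : ∀ x y → x +ₜ (y - x) ≡ y
    x+[y-x]≡y x y = ≡.trans (comm x (y - x)) (//-rightDividesˡ x y)
    point≡q : point q₃ (q₂ - q₃) (q₁ - q₃) ≡ q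
    point≡q = lookup-≗⇒≡ (onPlane-unique {1F} {2F} {3F} (λ ()) (λ ()) (λ ())
      (point-onPlane q₃ (q₂ - q₃) (q₁ - q₃)) q-on (x+[y-x]≡y q₃ q₁) (x+[y-x]≡y q₃ q₂) refl)

  length-deduplicate-𝒮 : length (deduplicate _≟Q_ (𝒮 N r)) ≡ N ^ 3
  length-deduplicate-𝒮 = ≡.trans (cong length (deduplicate-unique _≟Q_ 𝒮-unique)) length-𝒮

  𝒮-steiner : (x₁ x₂ x₃ : Fin N) (i j k : Fin 4) → i ≢ j → i ≢ k → j ≢ k →
    Σ (Quad N) (λ q → (q ∈ 𝒮 N r × q ∋ₚ x₁ , i × q ∋ₚ x₂ , j × q ∋ₚ x₃ , k)
      × ((q′ : Quad N) → q′ ∈ 𝒮 N r → q′ ∋ₚ x₁ , i → q′ ∋ₚ x₂ , j → q′ ∋ₚ x₃ , k → q′ ≡ q))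
  𝒮-steiner x₁ x₂ x₃ i j k i≢j i≢k j≢k with onPlane-through i≢j i≢k j≢k x₁ x₂ x₃
  ... | q , q-on , qᵢ , qⱼ , qₖ = q , (onPlane⇒∈𝒮 q q-on , qᵢ , qⱼ , qₖ) , unique
    where
    unique : (q′ : Quad N) → q′ ∈ 𝒮 N r → q′ ∋ₚ x₁ , i → q′ ∋ₚ x₂ , j → q′ ∋ₚ x₃ , k → q′ ≡ q
    unique q′ q′∈ q′ᵢ q′ⱼ q′ₖ = lookup-≗⇒≡
      (onPlane-unique i≢j i≢k j≢k {q′} {q} (∈𝒮⇒onPlane q′∈) q-on
        (≡.trans q′ᵢ (≡.sym qᵢ)) (≡.trans q′ⱼ (≡.sym qⱼ)) (≡.trans q′ₖ (≡.sym qₖ)))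

mainTheorem12 : (t : ℕ) .{{_ : NonZero t}} (r : ℤ) →
    (length (deduplicate _≟Q_ (𝒮 t r)) ≡ t ^ 3)
    × ((x₁ x₂ x₃ : Fin t) (i j k : Fin 4) → i ≢ j → i ≢ k → j ≢ k →
        Σ (Quad t) (λ q → (q ∈ 𝒮 t r × q ∋ₚ x₁ , i × q ∋ₚ x₂ , j × q ∋ₚ x₃ , k)
          × ((q′ : Quad t) → q′ ∈ 𝒮 t r → q′ ∋ₚ x₁ , i → q′ ∋ₚ x₂ , j → q′ ∋ₚ x₃ , k → q′ ≡ q)))
mainTheorem12 (suc n) r = Design.length-deduplicate-𝒮 n r , Design.𝒮-steiner n r
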